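{- $\mathsf{colength}\,\mathsf{sieve}=\omega_{\mathbb{N}}$.
   Context: Conats $\overline{\mathbb{N}}$: coinductive with $\mathsf{cozero}$, $\mathsf{cosucc}$, ordered coinductively by $\mathsf{cozero}\sqsubseteq n$ and $\mathsf{cosucc}\,n\sqsubseteq\mathsf{cosucc}\,m$ if $n\sqsubseteq m$; $\omega_{\mathbb{N}}:=\mathsf{cosucc}\,\omega_{\mathbb{N}}$; order-equivalent conats are assumed equal (axiom). $\mathsf{colist}\,A$: coinductive with $\bot$, $\mathsf{cocons}\,a\,l$, ordered by $\bot\sqsubseteq l$ and $\mathsf{cocons}\,a\,l_1\sqsubseteq\mathsf{cocons}\,a\,l_2$ if $l_1\sqsubseteq l_2$; order-equivalent streams are assumed equal. $\mathsf{idl}\,s\,0=\mathsf{nil}$, $\mathsf{idl}\,\bot\,(i+1)=\mathsf{nil}$, $\mathsf{idl}(\mathsf{cocons}\,a\,s)(i+1)=\mathsf{cons}\,a\,(\mathsf{idl}\,s\,i)$. For monotone $h:\mathsf{list}\,A\to C$ (prefix order), $\overline h(s):=\sup_i h(\mathsf{idl}\,s\,i)$ (chosen supremum). $\mathsf{fold}\,z\,f$: $\mathsf{nil}\mapsto z$, $\mathsf{cons}\,a\,l\mapsto f\,a\,(\mathsf{fold}\,z\,f\,l)$. $\mathsf{colength}:=\overline{\mathsf{fold}\,\mathsf{cozero}\,(\lambda\_.\,\mathsf{cosucc})}:\mathsf{colist}\,A\to\overline{\mathbb{N}}$. $\mathsf{filter}\,f:=\overline{\mathsf{fold}\,\bot\,(\lambda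 a\,l.\,\text{if }f\,a\text{ then }\mathsf{cocons}\,a\,l\text{ else }l)}$. $\mathsf{nats}\,n:=\mathsf{cocons}\,n\,(\mathsf{nats}(n+1))$, $n:\mathbb{Z}$. $\mathsf{sieve\_aux}:=\overline{\mathsf{fold}\,\bot\,(\lambda n\,l.\,\mathsf{cocons}\,n\,(\mathsf{filter}\,(\lambda m.\,m\bmod n\ne0)\,l))}$, $\mathsf{sieve}:=\mathsf{sieve\_aux}(\mathsf{nats}\,2)$. -}

module Defs where

-- The coinductive types of the paper
-- are therefore encoded by their standard "sequence of observations"
-- presentation (the final coalgebra of X ↦ 1 + A × X realised on ℕ → Maybe A),
-- together with the destructor 'out' (the coalgebra structure) and the
-- constructors cozero/cosucc, ⊥/cocons.  The coinductive orders are the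
-- greatest fixed points of the defining rules, expressed as the intersection
-- of their finite unfoldings (the rule functor is finitary, so this is the gfp).

open import Data.Nat using (ℕ; zero; suc)
open import Data.Integer using (ℤ; +_; -[1+_]; _+_; _%_)
open import Data.Integer.Properties using (_≟_)
open import Data.Bool using (Bool; true; false; if_then_else_; not)
open import Data.Maybe using (Maybe; just; nothing)
open import Data.Product using (_×_; _,_)
open import Data.Unit using (⊤)
open import Data.Empty using (⊥)
open import Data.List using (List; []; _∷_; foldr)
open import Relation.Nullary using (does)
open import Relation.Binary.PropositionalEquality using (_≡_)

-- Conats:  n i = true  means "n has at least i+1 cosucc's"

Conat : Set
Conat = ℕ → Bool

cozero : Conat
cozero _ = false

cosucc : Conat → Conat
cosucc n zero    = true
cosucc n (suc i) = n i

ωℕ : Conat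
ωℕ _ = true

data ConatView : Set where
  cozeroV : ConatView
  cosuccV : Conat → ConatView

outℕ : Conat → ConatView
outℕ n with n zero
... | false = cozeroV
... | true  = cosuccV (λ i → n (suc i))

-- k-th unfolding of the coinductive order
--   cozero ⊑ n ,   cosucc n ⊑ cosucc m  if  n ⊑ m
infix 4 _⊑ℕ_ _≈ℕ_ _⊑L_
⊑ℕ-approx : ℕ → ConatView → ConatView → Set
⊑ℕ-approx zero    _           _           = ⊤
⊑ℕ-approx (suc k) cozeroV     _           = ⊤
⊑ℕ-approx (suc k) (cosuccV n) cozeroV     = ⊥
⊑ℕ-approx (suc k) (cosuccV n) (cosuccV m) = ⊑ℕ-approx k (outℕ n) (outℕ m)

_⊑ℕ_ : Conat → Conat → Set
n ⊑ℕ m = ∀ k → ⊑ℕ-approx k (outℕ n) (outℕ m)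

-- order-equivalence (the paper assumes order-equivalent conats are equal)
_≈ℕ_ : Conat → Conat → Set
n ≈ℕ m = (n ⊑ℕ m) × (m ⊑ℕ n)

-- Colists:  l i = just a  means "the (i+1)-st observation is cocons a _"

Colist : Set → Set
Colist A = ℕ → Maybe A

bot : ∀ {A} → Colist A
bot _ = nothing

cocons : ∀ {A} → A → Colist A → Colist A
cocons a l zero    = just a
cocons a l (suc i) = l i

data ColistView (A : Set) : Set where
  botV    : ColistView A
  coconsV : A → Colist A → ColistView A

outL : ∀ {A} → Colist A → ColistView A
outL l with l zero
... | nothing = botV
... | just a  = coconsV a (λ i → l (suc i))

-- k-th unfolding of the coinductive order
--   ⊥ ⊑ l ,   cocons a l₁ ⊑ cocons a l₂  if  l₁ ⊑ l₂
⊑L-approx : ∀ {A} → ℕ → ColistView A → ColistView A → Set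
⊑L-approx zero    _               _               = ⊤
⊑L-approx (suc k) botV            _               = ⊤
⊑L-approx (suc k) (coconsV a l₁)  botV            = ⊥
⊑L-approx (suc k) (coconsV a l₁)  (coconsV b l₂)  =
  (a ≡ b) × ⊑L-approx k (outL l₁) (outL l₂)

_⊑L_ : ∀ {A} → Colist A → Colist A → Set
l₁ ⊑L l₂ = ∀ k → ⊑L-approx k (outL l₁) (outL l₂)

IsSupOp : {X : Set} → (X → X → Set) → ((ℕ → X) → X) → Set
IsSupOp {X} _⊑_ sup =
  (c : ℕ → X) → (∀ i → c i ⊑ c (suc i)) →
  (∀ i → c i ⊑ sup c) × ((u : X) → (∀ i → c i ⊑ u) → sup c ⊑ u)

idl : ∀ {A} → Colist A → ℕ → List A
idl s zero = []
idl s (suc i) with outL s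
... | botV        = []
... | coconsV a t = a ∷ idl t i

ext : ∀ {A C : Set} → ((ℕ → C) → C) → (List A → C) → Colist A → C
ext sup h s = sup (λ i → h (idl s i))

fold : ∀ {A C : Set} → C → (A → C → C) → List A → C
fold z f = foldr f z

colength : ∀ {A} → ((ℕ → Conat) → Conat) → Colist A → Conat
colength supN = ext supN (fold cozero (λ _ → cosucc))

filter : ∀ {A} → ((ℕ → Colist A) → Colist A) → (A → Bool) → Colist A → Colist A
filter supL f = ext supL (fold bot (λ a l → if f a then cocons a l else l))

-- nats n = cocons n (nats (n+1))  (pointwise: i-th element is n + i)
nats : ℤ → Colist ℤ
nats n i = just (n + + i)

-- integer mod (Euclidean remainder, stdlib _%_), with the convention m mod 0 = m
_modℤ_ : ℤ → ℤ → ℤ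
m modℤ (+ zero)    = m
m modℤ (+ (suc k)) = + (m % + (suc k))
m modℤ -[1+ k ]    = + (m % -[1+ k ])

modNonzero : ℤ → ℤ → Bool
modNonzero m n = not (does ((m modℤ n) ≟ + 0))

sieve-aux : ((ℕ → Colist ℤ) → Colist ℤ) → Colist ℤ → Colist ℤ
sieve-aux supL =
  ext supL (fold bot (λ n l → cocons n (filter supL (λ m → modNonzero m n) l)))

sieve : ((ℕ → Colist ℤ) → Colist ℤ) → Colist ℤ
sieve supL = sieve-aux supL (nats (+ 2))

module Submission where

-- The finite sieve of Eratosthenes on [2 … j+1] lies below sieve in the colist order: every
-- operation in sieve is an extension h̄, and h̄ is monotone and bounds each h (idl s i) from above.
-- A prime p = j+2 is not removed by any filter of that finite sieve, so by Euclid's theorem its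
-- length is unbounded in j; hence so are the lengths of the initial segments of sieve, and the
-- colength, an upper bound of those lengths, is ω.

open import Defs
open import Data.Bool using (Bool; true; false; T; if_then_else_)
open import Data.Empty using (⊥-elim)
open import Data.Integer using (ℤ; +_)
open import Data.List using (List; []; _∷_; _++_; _∷ʳ_; [_]; length; applyUpTo; filterᵇ)
open import Data.List.Properties using (length-++; filter-++; filter-accept; applyUpTo-∷ʳ)
open import Data.List.Relation.Binary.Prefix.Heterogeneous using (Prefix; []; _∷_)
open import Data.List.Relation.Binary.Prefix.Heterogeneous.Properties using (length-mono)
open import Data.List.Relation.Unary.All using (All; []; _∷_)
open import Data.List.Relation.Unary.All.Properties using (applyUpTo⁺₁)
open import Data.Maybe using (just)
open import Data.Nat as ℕ using (ℕ; zero; suc; _≤_; _<_; _≤′_; z≤n; s≤s; _!; NonZero)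
open import Data.Nat.Properties
  using (≤-refl; ≤-trans; ≤⇒≤′; ≮⇒≥; m≤m+n; +-comm; suc-injective; <⇒≢; 1≤n!; _<?_; module ≤-Reasoning)
open import Data.Nat.Divisibility using (_∣_; m%n≡0⇒n∣m; m∣m*n; ∣-trans; m≤n⇒m!∣n!; ∣m+n∣m⇒∣n; ∣1⇒≡1)
open import Data.Nat.Primality using (Prime; composite; ¬prime[1]; prime⇒nonZero)
open import Data.Nat.Primality.Factorisation using (factorise)
open import Data.Product using (∃-syntax; _×_; _,_; proj₁; proj₂)
open import Data.Unit using (tt)
open import Function using (_∘_)
open import Relation.Binary.Core using (_Preserves_⟶_)
open import Relation.Binary.Definitions using (Reflexive; Transitive; Minimum; Maximum)
open import Relation.Binary.PropositionalEquality
  using (_≡_; refl; sym; trans; cong; subst; module ≡-Reasoning)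
open import Relation.Nullary using (¬_; yes; no; T?)

module _ {A : Set} where

  ⊑L-approx-refl : ∀ k (v : ColistView A) → ⊑L-approx k v v
  ⊑L-approx-refl zero    _             = tt
  ⊑L-approx-refl (suc k) botV          = tt
  ⊑L-approx-refl (suc k) (coconsV a l) = refl , ⊑L-approx-refl k (outL l)

  ⊑L-approx-trans : ∀ k {u v w : ColistView A} →
                    ⊑L-approx k u v → ⊑L-approx k v w → ⊑L-approx k u w
  ⊑L-approx-trans zero                                          _          _          = tt
  ⊑L-approx-trans (suc k) {botV}                                _          _          = tt
  ⊑L-approx-trans (suc k) {coconsV _ _} {botV}                  ()         _
  ⊑L-approx-trans (suc k) {coconsV _ _} {coconsV _ _} {botV}    _          ()
  ⊑L-approx-trans (suc k) {coconsV _ _} {coconsV _ _} {coconsV _ _} (refl , p) (refl , q) =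
    refl , ⊑L-approx-trans k p q

  ⊑L-refl : Reflexive (_⊑L_ {A})
  ⊑L-refl {s} k = ⊑L-approx-refl k (outL s)

  ⊑L-trans : Transitive (_⊑L_ {A})
  ⊑L-trans p q k = ⊑L-approx-trans k (p k) (q k)

  bot-minimum : Minimum (_⊑L_ {A}) bot
  bot-minimum s zero    = tt
  bot-minimum s (suc k) = tt

  cocons-mono : ∀ a {s t : Colist A} → s ⊑L t → cocons a s ⊑L cocons a t
  cocons-mono a p zero    = tt
  cocons-mono a p (suc k) = refl , p k

  idl-chain : ∀ (s : Colist A) i → Prefix _≡_ (idl s i) (idl s (suc i))
  idl-chain s zero = []
  idl-chain s (suc i) with outL s
  ... | botV        = []
  ... | coconsV a t = refl ∷ idl-chain t i

  idl-mono-approx : ∀ i {s t : Colist A} → ⊑L-approx i (outL s) (outL t) →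
                    Prefix _≡_ (idl s i) (idl t i)
  idl-mono-approx zero    _ = []
  idl-mono-approx (suc i) {s} {t} p with outL s | outL t
  ... | botV        | _           = []
  ... | coconsV _ _ | botV        = ⊥-elim p
  ... | coconsV _ _ | coconsV _ _ = proj₁ p ∷ idl-mono-approx i (proj₂ p)

  idl-mono : ∀ {s t : Colist A} → s ⊑L t → ∀ i → Prefix _≡_ (idl s i) (idl t i)
  idl-mono p i = idl-mono-approx i (p i)

  idl-just : ∀ (f : ℕ → A) j → idl (just ∘ f) j ≡ applyUpTo f j
  idl-just f zero    = refl
  idl-just f (suc j) = cong (f 0 ∷_) (idl-just (f ∘ suc) j)

  fromList : List A → Colist A
  fromList []       = bot
  fromList (x ∷ xs) = cocons x (fromList xs)

  idl-fromList : ∀ xs → idl (fromList xs) (length xs) ≡ xs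
  idl-fromList []       = refl
  idl-fromList (x ∷ xs) = cong (x ∷_) (idl-fromList xs)

  fromList-⊑⇒prefix : ∀ {xs s} → fromList xs ⊑L s → Prefix _≡_ xs (idl s (length xs))
  fromList-⊑⇒prefix {xs} {s} p =
    subst (λ ys → Prefix _≡_ ys (idl s (length xs))) (idl-fromList xs) (idl-mono p (length xs))

module Extension {C : Set} (_⊑_ : C → C → Set) {sup : (ℕ → C) → C}
                 (isSup : IsSupOp _⊑_ sup) {A : Set} {h : List A → C}
                 (h-mono : h Preserves Prefix _≡_ ⟶ _⊑_) where

  ext-upper : ∀ s i → h (idl s i) ⊑ ext sup h s
  ext-upper s = proj₁ (isSup (h ∘ idl s) (h-mono ∘ idl-chain s))

  ext-mono : Transitive _⊑_ → ext sup h Preserves _⊑L_ ⟶ _⊑_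
  ext-mono ⊑-trans {s} {t} s⊑t =
    proj₂ (isSup (h ∘ idl s) (h-mono ∘ idl-chain s)) (ext sup h t)
      (λ i → ⊑-trans (h-mono (idl-mono s⊑t i)) (ext-upper t i))

open Extension using (ext-upper; ext-mono)

module _ {A : Set} where

  filterFold : (A → Bool) → List A → Colist A
  filterFold f = fold bot (λ a l → if f a then cocons a l else l)

  filterFold-mono : ∀ f → filterFold f Preserves Prefix _≡_ ⟶ _⊑L_
  filterFold-mono f {y = ys} []         = bot-minimum (filterFold f ys)
  filterFold-mono f (_∷_ {a = x} refl p) with f x
  ... | true  = cocons-mono x (filterFold-mono f p)
  ... | false = filterFold-mono f p

  fromList-filter⊑filterFold : ∀ f xs → fromList (filterᵇ f xs) ⊑L filterFold f xs
  fromList-filter⊑filterFold f []       = ⊑L-refl {x = bot}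
  fromList-filter⊑filterFold f (x ∷ xs) with f x
  ... | true  = cocons-mono x (fromList-filter⊑filterFold f xs)
  ... | false = fromList-filter⊑filterFold f xs

  module _ {sup : (ℕ → Colist A) → Colist A} (isSup : IsSupOp _⊑L_ sup) where

    filter-mono : ∀ f → filter sup f Preserves _⊑L_ ⟶ _⊑L_
    filter-mono f = ext-mono _⊑L_ isSup (filterFold-mono f) ⊑L-trans

    fromList-filter⊑filter : ∀ f xs {s} → fromList xs ⊑L s →
                             fromList (filterᵇ f xs) ⊑L filter sup f s
    fromList-filter⊑filter f xs xs⊑s =
      ⊑L-trans (fromList-filter⊑filterFold f xs)
        (⊑L-trans (subst (λ ys → filterFold f ys ⊑L filter sup f (fromList xs)) (idl-fromList xs)
                    (ext-upper _⊑L_ isSup (filterFold-mono f) (fromList xs) (length xs)))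
          (filter-mono f xs⊑s))

sieveFold : ((ℕ → Colist ℤ) → Colist ℤ) → List ℤ → Colist ℤ
sieveFold supL = fold bot (λ n l → cocons n (filter supL (λ m → modNonzero m n) l))

sieveList : List ℤ → List ℤ
sieveList []      = []
sieveList (n ∷ l) = n ∷ filterᵇ (λ m → modNonzero m n) (sieveList l)

module _ {supL : (ℕ → Colist ℤ) → Colist ℤ} (isSupL : IsSupOp _⊑L_ supL) where

  sieveFold-mono : sieveFold supL Preserves Prefix _≡_ ⟶ _⊑L_
  sieveFold-mono {y = ys} []   = bot-minimum (sieveFold supL ys)
  sieveFold-mono (_∷_ {a = n} refl p) =
    cocons-mono n (filter-mono isSupL (λ m → modNonzero m n) (sieveFold-mono p))

  fromList-sieveList⊑sieveFold : ∀ l → fromList (sieveList l) ⊑L sieveFold supL l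
  fromList-sieveList⊑sieveFold []      = ⊑L-refl {x = bot}
  fromList-sieveList⊑sieveFold (n ∷ l) =
    cocons-mono n (fromList-filter⊑filter isSupL (λ m → modNonzero m n) (sieveList l)
                    (fromList-sieveList⊑sieveFold l))

  fromList-sieveList⊑sieve-aux : ∀ s i → fromList (sieveList (idl s i)) ⊑L sieve-aux supL s
  fromList-sieveList⊑sieve-aux s i =
    ⊑L-trans (fromList-sieveList⊑sieveFold (idl s i)) (ext-upper _⊑L_ isSupL sieveFold-mono s i)

sift : List ℤ → List ℤ → List ℤ
sift []      xs = xs
sift (n ∷ l) xs = filterᵇ (λ m → modNonzero m n) (sift l xs)

sieveList-++ : ∀ l r → sieveList (l ++ r) ≡ sieveList l ++ sift l (sieveList r)
sieveList-++ []      r = refl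
sieveList-++ (n ∷ l) r = cong (n ∷_) (begin
  filterᵇ p (sieveList (l ++ r))                        ≡⟨ cong (filterᵇ p) (sieveList-++ l r) ⟩
  filterᵇ p (sieveList l ++ sift l (sieveList r))       ≡⟨ filter-++ (T? ∘ p) (sieveList l) _ ⟩
  filterᵇ p (sieveList l) ++ sift (n ∷ l) (sieveList r) ∎)
  where
  open ≡-Reasoning
  p : ℤ → Bool
  p m = modNonzero m n

sift-survivor : ∀ {y} l → All (λ n → T (modNonzero y n)) l → sift l [ y ] ≡ [ y ]
sift-survivor []      []       = refl
sift-survivor (n ∷ l) (n∤y ∷ ps) =
  trans (cong (filterᵇ (λ m → modNonzero m n)) (sift-survivor l ps))
        (filter-accept (T? ∘ λ m → modNonzero m n) n∤y)

segment : ℕ → List ℤ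
segment = applyUpTo (λ i → + (2 ℕ.+ i))

idl-nats : ∀ j → idl (nats (+ 2)) j ≡ segment j
idl-nats = idl-just (λ i → + (2 ℕ.+ i))

survivors : ℕ → ℕ
survivors j = length (sieveList (segment j))

survivors-suc : ∀ j → survivors (suc j) ≡ survivors j ℕ.+ length (sift (segment j) [ + (2 ℕ.+ j) ])
survivors-suc j = begin
  length (sieveList (segment (suc j)))
    ≡⟨ cong (length ∘ sieveList) (applyUpTo-∷ʳ _ j) ⟨
  length (sieveList (segment j ∷ʳ + (2 ℕ.+ j)))
    ≡⟨ cong length (sieveList-++ (segment j) _) ⟩
  length (sieveList (segment j) ++ sift (segment j) [ + (2 ℕ.+ j) ])
    ≡⟨ length-++ (sieveList (segment j)) ⟩
  survivors j ℕ.+ length (sift (segment j) [ + (2 ℕ.+ j) ])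
    ∎
  where open ≡-Reasoning

survivors-step : ∀ j → survivors j ≤ survivors (suc j)
survivors-step j = subst (survivors j ≤_) (sym (survivors-suc j)) (m≤m+n _ _)

survivors-mono : ∀ {j j'} → j ≤′ j' → survivors j ≤ survivors j'
survivors-mono ℕ.≤′-refl                = ≤-refl
survivors-mono (ℕ.≤′-step {j'} j≤′j') = ≤-trans (survivors-mono j≤′j') (survivors-step j')

¬∣⇒modNonzero : ∀ {m k} → ¬ (suc k ∣ m) → T (modNonzero (+ m) (+ suc k))
¬∣⇒modNonzero {m} {k} k+1∤m with m ℕ.% suc k in eq
... | zero  = ⊥-elim (k+1∤m (m%n≡0⇒n∣m m (suc k) eq))
... | suc _ = tt

prime-survives-segment : ∀ j → Prime (2 ℕ.+ j) → All (λ n → T (modNonzero (+ (2 ℕ.+ j)) n)) (segment j)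
prime-survives-segment j p = applyUpTo⁺₁ _ j
  (λ i<j → ¬∣⇒modNonzero (λ 2+i∣2+j → Prime.notComposite p (composite (s≤s (s≤s i<j)) 2+i∣2+j)))

survivors-prime : ∀ j → Prime (2 ℕ.+ j) → survivors (suc j) ≡ suc (survivors j)
survivors-prime j p = begin
  survivors (suc j)                                         ≡⟨ survivors-suc j ⟩
  survivors j ℕ.+ length (sift (segment j) [ + (2 ℕ.+ j) ]) ≡⟨ cong (λ xs → survivors j ℕ.+ length xs)
                                                                   (sift-survivor (segment j) (prime-survives-segment j p)) ⟩
  survivors j ℕ.+ 1                                         ≡⟨ +-comm (survivors j) 1 ⟩
  suc (survivors j)                                         ∎
  where open ≡-Reasoning

m∣n! : ∀ {m n} → .{{NonZero m}} → m ≤ n → m ∣ n !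
m∣n! {suc m} m≤n = ∣-trans (m∣m*n (m !)) (m≤n⇒m!∣n! m≤n)

prime∣suc-n!⇒n<p : ∀ {p n} → Prime p → p ∣ suc (n !) → n < p
prime∣suc-n!⇒n<p {p} {n} pp p∣n!+1 with n <? p
... | yes n<p = n<p
... | no  n≮p = ⊥-elim (¬prime[1] (subst Prime (∣1⇒≡1 p∣1) pp))
  where
  p∣1 : p ∣ 1
  p∣1 = ∣m+n∣m⇒∣n (subst (p ∣_) (+-comm 1 (n !)) p∣n!+1)
                  (m∣n! {{prime⇒nonZero pp}} (≮⇒≥ n≮p))

prime-above : ∀ n → ∃[ p ] Prime p × n < p
prime-above n with factorise (suc (n !))
... | record { factors = [] ; isFactorisation = n!+1≡1 } =
  ⊥-elim (<⇒≢ (1≤n! n) (sym (suc-injective n!+1≡1)))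
... | record { factors = p ∷ ps ; isFactorisation = n!+1≡Πps ; factorsPrime = pp ∷ _ } =
  p , pp , prime∣suc-n!⇒n<p pp (subst (p ∣_) (sym n!+1≡Πps) (m∣m*n _))

survivors-unbounded : ∀ k → ∃[ j ] k ≤ survivors j
survivors-unbounded zero = 0 , z≤n
survivors-unbounded (suc k) with survivors-unbounded k
... | j , k≤ with prime-above (suc j)
... | suc (suc j') , pp , s≤s (s≤s j≤j') = suc j' , (begin
  suc k                ≤⟨ s≤s k≤ ⟩
  suc (survivors j)    ≤⟨ s≤s (survivors-mono (≤⇒≤′ j≤j')) ⟩
  suc (survivors j')   ≡⟨ survivors-prime j' pp ⟨
  survivors (suc j')   ∎)
  where open ≤-Reasoning

⊑ℕ-approx-trans : ∀ k {u v w : ConatView} → ⊑ℕ-approx k u v → ⊑ℕ-approx k v w → ⊑ℕ-approx k u w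
⊑ℕ-approx-trans zero                                          _ _ = tt
⊑ℕ-approx-trans (suc k) {cozeroV}                             _ _ = tt
⊑ℕ-approx-trans (suc k) {cosuccV _} {cozeroV}                 () _
⊑ℕ-approx-trans (suc k) {cosuccV _} {cosuccV _} {cozeroV}     _ ()
⊑ℕ-approx-trans (suc k) {cosuccV _} {cosuccV _} {cosuccV _}   p q = ⊑ℕ-approx-trans k p q

⊑ℕ-approx-ωℕ : ∀ k v → ⊑ℕ-approx k v (outℕ ωℕ)
⊑ℕ-approx-ωℕ zero    _           = tt
⊑ℕ-approx-ωℕ (suc k) cozeroV     = tt
⊑ℕ-approx-ωℕ (suc k) (cosuccV n) = ⊑ℕ-approx-ωℕ k (outℕ n)

ωℕ-maximum : Maximum _⊑ℕ_ ωℕ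
ωℕ-maximum n k = ⊑ℕ-approx-ωℕ k (outℕ n)

module _ {A : Set} where

  colengthFold : List A → Conat
  colengthFold = fold cozero (λ _ → cosucc)

  colengthFold-mono : colengthFold Preserves Prefix _≡_ ⟶ _⊑ℕ_
  colengthFold-mono _       zero    = tt
  colengthFold-mono []      (suc k) = tt
  colengthFold-mono (_ ∷ p) (suc k) = colengthFold-mono p k

  ωℕ-approx-colengthFold : ∀ k xs → k ≤ length xs → ⊑ℕ-approx k (outℕ ωℕ) (outℕ (colengthFold xs))
  ωℕ-approx-colengthFold zero    _        _         = tt
  ωℕ-approx-colengthFold (suc k) (_ ∷ xs) (s≤s k≤n) = ωℕ-approx-colengthFold k xs k≤n

  ωℕ⊑colength : ∀ {supN} → IsSupOp _⊑ℕ_ supN → ∀ {s : Colist A} →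
                (∀ k → ∃[ i ] k ≤ length (idl s i)) → ωℕ ⊑ℕ colength supN s
  ωℕ⊑colength isSupN {s} long k with long k
  ... | i , k≤ = ⊑ℕ-approx-trans k (ωℕ-approx-colengthFold k (idl s i) k≤)
                                   (ext-upper _⊑ℕ_ isSupN colengthFold-mono s i k)

sieve-long : ∀ {supL} → IsSupOp _⊑L_ supL → ∀ k → ∃[ i ] k ≤ length (idl (sieve supL) i)
sieve-long {supL} isSupL k with survivors-unbounded k
... | j , k≤ = length finiteSieve ,
  ≤-trans k≤ (length-mono (fromList-⊑⇒prefix {xs = finiteSieve} finiteSieve⊑sieve))
  where
  finiteSieve : List ℤ
  finiteSieve = sieveList (segment j)

  finiteSieve⊑sieve : fromList finiteSieve ⊑L sieve supL
  finiteSieve⊑sieve = subst (λ l → fromList (sieveList l) ⊑L sieve supL) (idl-nats j)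
                        (fromList-sieveList⊑sieve-aux isSupL (nats (+ 2)) j)

mainTheorem9 : (supN : (ℕ → Conat) → Conat) → IsSupOp _⊑ℕ_ supN →
               (supL : (ℕ → Colist ℤ) → Colist ℤ) → IsSupOp _⊑L_ supL →
               colength supN (sieve supL) ≈ℕ ωℕ
mainTheorem9 supN isSupN supL isSupL =
  ωℕ-maximum (colength supN (sieve supL)) , ωℕ⊑colength isSupN (sieve-long isSupL)
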